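{- For every $n\ge 1$, the number of simple $n$-braids (the cardinality of $\mathcal{SB}_n$) equals $F_{2n-1}$.
   Context: $(F_n)_{n\ge 0}$ is the Fibonacci sequence $F_0=0$, $F_1=1$, $F_{n+1}=F_n+F_{n-1}$. The monoid of positive $n$-braids $\mathcal{MB}_n$ is the monoid with generators $x_1,\dots,x_{n-1}$ and relations $x_ix_j=x_jx_i$ for $|i-j|\ge 2$ and $x_ix_{i+1}x_i=x_{i+1}x_ix_{i+1}$ for $1\le i\le n-2$. A simple braid is a positive braid $\beta\in\mathcal{MB}_n$ that can be represented by a positive word in which each letter $x_i$ occurs at most once; $\mathcal{SB}_n$ denotes the set of simple $n$-braids (including the identity). -}

module Defs where

open import Data.Nat using (ℕ; zero; suc; _+_; _*_; _≤_; _∸_)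
open import Data.Fin using (Fin; toℕ)
open import Data.List using (List; []; _∷_; _++_; length)
open import Data.List.Relation.Unary.Unique.Propositional using (Unique)
open import Data.List.Relation.Unary.AllPairs using (AllPairs)
open import Data.List.Relation.Unary.All using (All)
open import Data.List.Relation.Unary.Any using (Any)
open import Data.Product using (Σ; _×_)
open import Relation.Nullary using (¬_)
open import Relation.Binary.PropositionalEquality using (_≡_)

fib : ℕ → ℕ
fib zero = 0
fib (suc zero) = 1
fib (suc (suc n)) = fib (suc n) + fib n

-- Positive words in the generators of MB_{m+1}: generator x_{i+1} is i : Fin m.
Word : ℕ → Set
Word m = List (Fin m)

data Rel {m : ℕ} : Word m → Word m → Set where
  -- x_i x_j = x_j x_i for |i - j| ≥ 2  (here toℕ i + 2 ≤ toℕ j; symmetry of ≈ gives the rest)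
  comm  : (i j : Fin m) → toℕ i + 2 ≤ toℕ j → Rel (i ∷ j ∷ []) (j ∷ i ∷ [])
  braid : (i j : Fin m) → toℕ j ≡ suc (toℕ i) →
          Rel (i ∷ j ∷ i ∷ []) (j ∷ i ∷ j ∷ [])

-- Monoid congruence generated by Rel: two positive words represent the
-- same positive braid iff they are related by _≈_.
data _≈_ {m : ℕ} : Word m → Word m → Set where
  ≈-refl  : ∀ {u} → u ≈ u
  ≈-sym   : ∀ {u v} → u ≈ v → v ≈ u
  ≈-trans : ∀ {u v w} → u ≈ v → v ≈ w → u ≈ w
  ≈-step  : ∀ {l r} (u v : Word m) → Rel l r → (u ++ l ++ v) ≈ (u ++ r ++ v)

SimpleWord : ∀ {m} → Word m → Set
SimpleWord w = Unique w

-- |SB_n| = k : there is a list of k simple words (in the n-1 generators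
-- of MB_n) representing pairwise distinct braids, and every simple braid
-- (i.e. every braid represented by a simple word) is represented by one of them.
CountSimpleBraids : ℕ → ℕ → Set
CountSimpleBraids n k =
  Σ (List (Word (n ∸ 1))) λ L →
    length L ≡ k
    × All SimpleWord L
    × AllPairs (λ u v → ¬ (u ≈ v)) L
    × (∀ (w : Word (n ∸ 1)) → SimpleWord w → Any (λ v → w ≈ v) L)

module Submission where

-- Words over Fin m are positive words in the generators x₁,…,x_m of MB_{m+1};
-- `shift` renames x_i to x_{i+1}.  We construct an explicit list
-- `canonical m` of simple words, split into the words `avoiding m` that do
-- not use x₁ and the words `containing m` that do:
--   avoiding (m+1)   = shift c                  for c ∈ canonical m,
--   containing (m+1) = x₁ · shift c            for c ∈ canonical m,
--                      shift c · x₁            for c ∈ containing m.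
-- The theorem then follows from four facts about this list:
--   * counting: |containing m| = F_{2m} and |canonical m| = F_{2m+1};
--   * simplicity: every canonical word is simple;
--   * distinctness: braids act on the strands of a vector by permuting them,
--     and distinct canonical words already permute a vector with distinct
--     entries differently (they are told apart by the entry they move to the
--     front), so they represent distinct braids;
--   * completeness: in a simple word x₁ occurs at most once and x₂ can not
--     occur on both sides of it; as x₁ commutes with x₃,…, it can be slid to
--     the front or to the back, which yields a canonical word by induction.

open import Defs
open import Data.Nat using (ℕ; zero; suc; _+_; _*_; _∸_; _≤_; s≤s; z≤n)
open import Data.Nat.Properties using (+-suc; +-comm; +-identityʳ)
  renaming (suc-injective to ℕ-suc-injective)
open import Data.Fin using (Fin; toℕ) renaming (zero to fzero; suc to fsuc)
open import Data.Fin.Properties using (suc-injective; toℕ-injective)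
open import Data.List using (List; []; _∷_; _++_; map; length; [_])
open import Data.List.Properties using (++-assoc; map-++; length-++; length-map)
open import Data.List.Relation.Unary.All as All using (All; []; _∷_)
import Data.List.Relation.Unary.All.Properties as AllP
open import Data.List.Relation.Unary.Any as Any using (Any; here; there)
open import Data.List.Relation.Unary.AllPairs as AllPairs using (AllPairs; []; _∷_)
import Data.List.Relation.Unary.AllPairs.Properties as AllPairsP
open import Data.List.Relation.Unary.Unique.Propositional using (Unique)
import Data.List.Relation.Unary.Unique.Propositional.Properties as UniqueP
open import Data.List.Relation.Binary.Disjoint.Propositional using (Disjoint)
import Data.List.Relation.Binary.Permutation.Setoid.Properties as PermP
open import Data.List.Membership.Propositional using (_∈_; find; lose)
open import Data.List.Membership.Propositional.Properties
  using (∈-map⁺; ∈-++⁺ˡ; ∈-++⁺ʳ; ∈-++⁻; ∈-∃++)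
open import Data.Vec using (Vec; _∷_; head; allFin)
open import Data.Vec.Properties using (∷-injectiveʳ)
open import Data.Vec.Relation.Unary.All as VecAll using (_∷_)
open import Data.Vec.Relation.Unary.AllPairs using (_∷_)
import Data.Vec.Relation.Unary.Unique.Propositional as VecUnique
import Data.Vec.Relation.Unary.Unique.Propositional.Properties as VecUniqueP
open import Data.Product using (Σ; _×_; _,_)
open import Data.Sum using (_⊎_; inj₁; inj₂)
open import Data.Empty using (⊥-elim)
open import Function using (_∘_)
open import Relation.Nullary using (¬_)
open import Relation.Binary.Bundles using (Setoid)
open import Relation.Binary.PropositionalEquality
  using (_≡_; _≢_; refl; sym; trans; cong; cong₂; subst; subst₂; setoid; module ≡-Reasoning)
import Relation.Binary.Reasoning.Setoid as SetoidReasoning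

≈-setoid : ℕ → Setoid _ _
≈-setoid m = record
  { Carrier       = Word m
  ; _≈_           = _≈_
  ; isEquivalence = record { refl = ≈-refl ; sym = ≈-sym ; trans = ≈-trans } }

≈-++ˡ : ∀ {m} (t : Word m) {u v : Word m} → u ≈ v → (t ++ u) ≈ (t ++ v)
≈-++ˡ t ≈-refl        = ≈-refl
≈-++ˡ t (≈-sym p)     = ≈-sym (≈-++ˡ t p)
≈-++ˡ t (≈-trans p q) = ≈-trans (≈-++ˡ t p) (≈-++ˡ t q)
≈-++ˡ t (≈-step {l} {r} u v rel) =
  subst₂ _≈_ (++-assoc t u (l ++ v)) (++-assoc t u (r ++ v)) (≈-step (t ++ u) v rel)

≈-++ʳ : ∀ {m} (t : Word m) {u v : Word m} → u ≈ v → (u ++ t) ≈ (v ++ t)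
≈-++ʳ t ≈-refl        = ≈-refl
≈-++ʳ t (≈-sym p)     = ≈-sym (≈-++ʳ t p)
≈-++ʳ t (≈-trans p q) = ≈-trans (≈-++ʳ t p) (≈-++ʳ t q)
≈-++ʳ t (≈-step {l} {r} u v rel) =
  subst₂ _≈_ (reassoc l) (reassoc r) (≈-step u (v ++ t) rel)
  where
  reassoc : ∀ l → u ++ l ++ v ++ t ≡ (u ++ l ++ v) ++ t
  reassoc l = trans (cong (u ++_) (sym (++-assoc l v t))) (sym (++-assoc u (l ++ v) t))

shift : ∀ {m} → Word m → Word (suc m)
shift = map fsuc

shift-rel : ∀ {m} {l r : Word m} → Rel l r → Rel (shift l) (shift r)
shift-rel (comm i j far)   = comm (fsuc i) (fsuc j) (s≤s far)
shift-rel (braid i j next) = braid (fsuc i) (fsuc j) (cong suc next)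

≈-shift : ∀ {m} {u v : Word m} → u ≈ v → shift u ≈ shift v
≈-shift ≈-refl        = ≈-refl
≈-shift (≈-sym p)     = ≈-sym (≈-shift p)
≈-shift (≈-trans p q) = ≈-trans (≈-shift p) (≈-shift q)
≈-shift (≈-step {l} {r} u v rel) =
  subst₂ _≈_ (distribute l) (distribute r) (≈-step (shift u) (shift v) (shift-rel rel))
  where
  distribute : ∀ l → shift u ++ shift l ++ shift v ≡ shift (u ++ l ++ v)
  distribute l = sym (trans (map-++ fsuc u (l ++ v)) (cong (shift u ++_) (map-++ fsuc l v)))

commute-past : ∀ {m} (i : Fin m) (u : Word m) →
               All (λ j → toℕ i + 2 ≤ toℕ j) u → (i ∷ u) ≈ (u ++ [ i ])
commute-past i []      []           = ≈-refl
commute-past i (j ∷ u) (far ∷ fars) =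
  ≈-trans (≈-step [] u (comm i j far)) (≈-++ˡ [ j ] (commute-past i u fars))

front back : ∀ {m} → Word m → Word (suc m)
front c = fzero ∷ shift c
back  c = shift c ++ [ fzero ]

mutual
  avoiding : (m : ℕ) → List (Word m)
  avoiding zero    = [ [] ]
  avoiding (suc m) = map shift (canonical m)

  containing : (m : ℕ) → List (Word m)
  containing zero    = []
  containing (suc m) = map front (canonical m) ++ map back (containing m)

  canonical : (m : ℕ) → List (Word m)
  canonical m = avoiding m ++ containing m

mutual
  length-containing : ∀ m → length (containing m) ≡ fib (m + m)
  length-containing zero    = refl
  length-containing (suc m) = begin
    length (map front (canonical m) ++ map back (containing m))
      ≡⟨ length-++ (map front (canonical m)) ⟩
    length (map front (canonical m)) + length (map back (containing m))
      ≡⟨ cong₂ _+_ (length-map front (canonical m)) (length-map back (containing m)) ⟩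
    length (canonical m) + length (containing m)
      ≡⟨ cong₂ _+_ (length-canonical m) (length-containing m) ⟩
    fib (suc (suc (m + m)))
      ≡⟨ cong (λ k → fib (suc k)) (sym (+-suc m m)) ⟩
    fib (suc m + suc m) ∎
    where open ≡-Reasoning

  length-canonical : ∀ m → length (canonical m) ≡ fib (suc (m + m))
  length-canonical zero    = refl
  length-canonical (suc m) = begin
    length (map shift (canonical m) ++ containing (suc m))
      ≡⟨ length-++ (map shift (canonical m)) ⟩
    length (map shift (canonical m)) + length (containing (suc m))
      ≡⟨ cong₂ _+_ (trans (length-map shift (canonical m)) (length-canonical m))
                   (length-containing (suc m)) ⟩
    fib (suc (m + m)) + fib (suc m + suc m)
      ≡⟨ cong (λ k → fib (suc (m + m)) + fib k) (+-suc (suc m) m) ⟩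
    fib (suc (m + m)) + fib (suc (suc (m + m)))
      ≡⟨ +-comm (fib (suc (m + m))) _ ⟩
    fib (suc (suc (suc (m + m))))
      ≡⟨ cong (λ k → fib (suc k)) (sym (+-suc (suc m) m)) ⟩
    fib (suc (suc m + suc m)) ∎
    where open ≡-Reasoning

double-suc-pred : ∀ m → 2 * suc m ∸ 1 ≡ suc (m + m)
double-suc-pred m = trans (+-suc m (m + 0)) (cong (λ k → suc (m + k)) (+-identityʳ m))

shift-unique : ∀ {m} {c : Word m} → Unique c → Unique (shift c)
shift-unique = UniqueP.map⁺ suc-injective

first∉shift : ∀ {m} (c : Word m) → All (fzero ≢_) (shift c)
first∉shift c = AllP.map⁺ (All.universal (λ _ ()) c)

front-unique : ∀ {m} {c : Word m} → Unique c → Unique (front c)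
front-unique {c = c} u = first∉shift c ∷ shift-unique u

back-unique : ∀ {m} {c : Word m} → Unique c → Unique (back c)
back-unique {c = c} u = UniqueP.++⁺ (shift-unique u) ([] ∷ []) disjoint
  where
  disjoint : Disjoint (shift c) [ fzero ]
  disjoint (first∈ , here refl) = All.lookup (first∉shift c) first∈ refl

canonical-simple : ∀ m → All SimpleWord (canonical m)
canonical-simple zero    = [] ∷ []
canonical-simple (suc m) =
  AllP.++⁺ (AllP.map⁺ (All.map shift-unique (canonical-simple m)))
    (AllP.++⁺ (AllP.map⁺ (All.map front-unique (canonical-simple m)))
              (AllP.map⁺ (All.map back-unique (AllP.++⁻ʳ (avoiding m) (canonical-simple m)))))

-- The permutation of strands induced by a word

swap : ∀ {A : Set} {m} → Fin m → Vec A (suc m) → Vec A (suc m)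
swap fzero    (a ∷ b ∷ xs) = b ∷ a ∷ xs
swap (fsuc i) (a ∷ xs)      = a ∷ swap i xs

act : ∀ {A : Set} {m} → Word m → Vec A (suc m) → Vec A (suc m)
act []      xs = xs
act (i ∷ w) xs = act w (swap i xs)

act-++ : ∀ {A : Set} {m} (u w : Word m) (xs : Vec A (suc m)) →
         act (u ++ w) xs ≡ act w (act u xs)
act-++ []      w xs = refl
act-++ (i ∷ u) w xs = act-++ u w (swap i xs)

swap-comm : ∀ {A : Set} {m} (i j : Fin m) → toℕ i + 2 ≤ toℕ j → (xs : Vec A (suc m)) →
            swap j (swap i xs) ≡ swap i (swap j xs)
swap-comm fzero    (fsuc (fsuc j)) _         (a ∷ b ∷ xs) = refl
swap-comm fzero    (fsuc fzero)    (s≤s ())  _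
swap-comm (fsuc i) (fsuc j)        (s≤s far) (a ∷ xs) = cong (a ∷_) (swap-comm i j far xs)

swap-braid : ∀ {A : Set} {m} (i j : Fin m) → toℕ j ≡ suc (toℕ i) → (xs : Vec A (suc m)) →
             swap i (swap j (swap i xs)) ≡ swap j (swap i (swap j xs))
swap-braid fzero    (fsuc fzero) _    (a ∷ b ∷ c ∷ xs) = refl
swap-braid (fsuc i) (fsuc j)     next (a ∷ xs) =
  cong (a ∷_) (swap-braid i j (ℕ-suc-injective next) xs)

act-rel : ∀ {A : Set} {m} {l r : Word m} → Rel l r → (xs : Vec A (suc m)) → act l xs ≡ act r xs
act-rel (comm i j far)   = swap-comm i j far
act-rel (braid i j next) = swap-braid i j next

act-≈ : ∀ {A : Set} {m} {u v : Word m} → u ≈ v → (xs : Vec A (suc m)) → act u xs ≡ act v xs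
act-≈ ≈-refl        xs = refl
act-≈ (≈-sym p)     xs = sym (act-≈ p xs)
act-≈ (≈-trans p q) xs = trans (act-≈ p xs) (act-≈ q xs)
act-≈ (≈-step {l} {r} u v rel) xs = begin
  act (u ++ l ++ v) xs        ≡⟨ act-++ u (l ++ v) xs ⟩
  act (l ++ v) (act u xs)     ≡⟨ act-++ l v _ ⟩
  act v (act l (act u xs))    ≡⟨ cong (act v) (act-rel rel _) ⟩
  act v (act r (act u xs))    ≡⟨ sym (act-++ r v _) ⟩
  act (r ++ v) (act u xs)     ≡⟨ sym (act-++ u (r ++ v) xs) ⟩
  act (u ++ r ++ v) xs        ∎
  where open ≡-Reasoning

swap-All : ∀ {A : Set} {P : A → Set} {m} (i : Fin m) {xs : Vec A (suc m)} →
           VecAll.All P xs → VecAll.All P (swap i xs)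
swap-All fzero    (pa ∷ pb ∷ ps) = pb ∷ pa ∷ ps
swap-All (fsuc i) (pa ∷ ps)             = pa ∷ swap-All i ps

act-All : ∀ {A : Set} {P : A → Set} {m} (c : Word m) {xs : Vec A (suc m)} →
          VecAll.All P xs → VecAll.All P (act c xs)
act-All []      ps = ps
act-All (i ∷ c) ps = act-All c (swap-All i ps)

act-shift : ∀ {A : Set} {m} (c : Word m) (x : A) (ys : Vec A (suc m)) →
            act (shift c) (x ∷ ys) ≡ x ∷ act c ys
act-shift []      x ys = refl
act-shift (i ∷ c) x ys = act-shift c x (swap i ys)

act-back : ∀ {A : Set} {m} (c : Word m) (x : A) (ys : Vec A (suc m)) →
           act (back c) (x ∷ ys) ≡ swap fzero (x ∷ act c ys)
act-back c x ys = trans (act-++ (shift c) [ fzero ] (x ∷ ys)) (cong (swap fzero) (act-shift c x ys))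

head-act-back : ∀ {A : Set} {m} (c : Word m) (x : A) (ys : Vec A (suc m)) →
                head (act (back c) (x ∷ ys)) ≡ head (act c ys)
head-act-back c x ys = trans (cong head (act-back c x ys)) (head-swap (act c ys))
  where
  head-swap : ∀ {n} (v : Vec _ (suc n)) → head (swap fzero (x ∷ v)) ≡ head v
  head-swap (y ∷ v) = refl

shift-determines : ∀ {A : Set} {m} {u v : Word m} {x : A} {ys : Vec A (suc m)} →
                   act (shift u) (x ∷ ys) ≡ act (shift v) (x ∷ ys) → act u ys ≡ act v ys
shift-determines {u = u} {v} {x} {ys} same =
  ∷-injectiveʳ (trans (sym (act-shift u x ys)) (trans same (act-shift v x ys)))

back-determines : ∀ {A : Set} {m} {u v : Word m} {x : A} {ys : Vec A (suc m)} →
                  act (back u) (x ∷ ys) ≡ act (back v) (x ∷ ys) → act u ys ≡ act v ys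
back-determines {u = u} {v} {x} {ys} same =
  swap-injective (trans (sym (act-back u x ys)) (trans same (act-back v x ys)))
  where
  swap-injective : ∀ {n} {w w′ : Vec _ (suc n)} → swap fzero (x ∷ w) ≡ swap fzero (x ∷ w′) → w ≡ w′
  swap-injective {w = _ ∷ _} {_ ∷ _} refl = refl

-- Distinctness: canonical words permute distinct strands differently

Separates : ∀ {A : Set} {m} → Vec A (suc m) → List (Word m) → Set
Separates xs L = AllPairs (λ u v → act u xs ≢ act v xs) L

separates-map : ∀ {A : Set} {k m} {f : Word k → Word m} {xs : Vec A (suc m)} {ys : Vec A (suc k)} →
                (∀ {u v} → act (f u) xs ≡ act (f v) xs → act u ys ≡ act v ys) →
                ∀ {L} → Separates ys L → Separates xs (map f L)
separates-map determines = AllPairsP.map⁺ ∘ AllPairs.map (λ different same → different (determines same))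

AllPairs-++⁻ʳ : ∀ {A : Set} {R : A → A → Set} (xs : List A) {ys : List A} →
                AllPairs R (xs ++ ys) → AllPairs R ys
AllPairs-++⁻ʳ []       rs       = rs
AllPairs-++⁻ʳ (x ∷ xs) (_ ∷ rs) = AllPairs-++⁻ʳ xs rs

Apart : ∀ {A : Set} {m} → Vec A (suc m) → List (Word m) → List (Word m) → Set
Apart xs L₁ L₂ = All (λ u → All (λ v → act u xs ≢ act v xs) L₂) L₁

separates-by-head : ∀ {A : Set} {m} {xs : Vec A (suc m)} {a : A} {L₁ L₂ : List (Word m)} →
                    All (λ u → head (act u xs) ≡ a) L₁ → All (λ v → head (act v xs) ≢ a) L₂ →
                    Apart xs L₁ L₂
separates-by-head toA notToA =
  All.map (λ toA-u → All.map (λ notToA-v same → notToA-v (trans (cong head (sym same)) toA-u)) notToA) toA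

All-head : ∀ {A : Set} {P : A → Set} {n} {v : Vec A (suc n)} → VecAll.All P v → P (head v)
All-head (p ∷ _) = p

containing-moves-head : ∀ {A : Set} {m} {ys : Vec A (suc m)} → VecUnique.Unique ys →
                        All (λ c → head (act c ys) ≢ head ys) (containing m)
containing-moves-head {m = zero} _ = []
containing-moves-head {m = suc m} {x ∷ y ∷ zs} ((x≢y ∷ x∉zs) ∷ _) =
  AllP.++⁺ (AllP.map⁺ (All.universal front-moves (canonical m)))
           (AllP.map⁺ (All.universal back-moves (containing m)))
  where
  front-moves : ∀ c → head (act (front c) (x ∷ y ∷ zs)) ≢ x
  front-moves c toX = x≢y (trans (sym toX) (cong head (act-shift c y (x ∷ zs))))
  back-moves : ∀ c → head (act (back c) (x ∷ y ∷ zs)) ≢ x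
  back-moves c toX = All-head (act-All c {y ∷ zs} (x≢y ∷ x∉zs))
                       (trans (sym toX) (head-act-back c x (y ∷ zs)))

canonical-separates : ∀ {A : Set} {m} {xs : Vec A (suc m)} → VecUnique.Unique xs →
                      Separates xs (canonical m)
canonical-separates {m = zero} _ = [] ∷ []
canonical-separates {m = suc m} {x ∷ y ∷ zs} distinct@((x≢y ∷ x∉zs) ∷ distinct-ys@(_ ∷ distinct-zs)) =
  AllPairsP.++⁺ among-avoiding
    (AllPairsP.++⁺ among-front among-back front-vs-back)
    avoiding-vs-containing
  where
  among-avoiding : Separates (x ∷ y ∷ zs) (map shift (canonical m))
  among-avoiding = separates-map (λ {u} {v} → shift-determines {u = u} {v} {x}) (canonical-separates distinct-ys)
  among-front : Separates (x ∷ y ∷ zs) (map front (canonical m))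
  among-front = separates-map (λ {u} {v} → shift-determines {u = u} {v} {y}) (canonical-separates {xs = x ∷ zs} (x∉zs ∷ distinct-zs))
  among-back : Separates (x ∷ y ∷ zs) (map back (containing m))
  among-back = separates-map (λ {u} {v} → back-determines {u = u} {v} {x})
    (AllPairs-++⁻ʳ (avoiding m) (canonical-separates distinct-ys))
  -- front words bring y to the front, back words do not
  front-vs-back : Apart (x ∷ y ∷ zs) (map front (canonical m)) (map back (containing m))
  front-vs-back = separates-by-head {a = y}
    (AllP.map⁺ (All.universal (λ c → cong head (act-shift c y (x ∷ zs))) (canonical m)))
    (AllP.map⁺ (All.map (λ {c} moves toY → moves (trans (sym (head-act-back c x (y ∷ zs))) toY))
                        (containing-moves-head distinct-ys)))
  -- avoiding words keep x at the front, containing words do not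
  avoiding-vs-containing : Apart (x ∷ y ∷ zs) (map shift (canonical m)) (containing (suc m))
  avoiding-vs-containing = separates-by-head {a = x}
    (AllP.map⁺ (All.universal (λ c → cong head (act-shift c x (y ∷ zs))) (canonical m)))
    (containing-moves-head distinct)

canonical-distinct : ∀ m → AllPairs (λ u v → ¬ (u ≈ v)) (canonical m)
canonical-distinct m =
  AllPairs.map (λ different equivalent → different (act-≈ equivalent (allFin (suc m))))
               (canonical-separates (VecUniqueP.tabulate⁺ (λ same → same)))

-- Completeness: every simple word is equivalent to a canonical one

AvoidsFirst : ∀ {m} → Word m → Set
AvoidsFirst u = All (λ j → 1 ≤ toℕ j) u

shift-avoids-first : ∀ {m} (c : Word m) → AvoidsFirst (shift c)
shift-avoids-first c = AllP.map⁺ (All.universal (λ _ → s≤s z≤n) c)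

avoiding-avoids-first : ∀ m → All AvoidsFirst (avoiding m)
avoiding-avoids-first zero    = [] ∷ []
avoiding-avoids-first (suc m) = AllP.map⁺ (All.universal shift-avoids-first (canonical m))

shift-far : ∀ {m} {u : Word m} → AvoidsFirst u → All (λ j → toℕ (fzero {m}) + 2 ≤ toℕ j) (shift u)
shift-far avoids = AllP.map⁺ (All.map s≤s avoids)

front-slide : ∀ {m} {a : Word m} (b : Word m) → AvoidsFirst a →
              (shift a ++ fzero ∷ shift b) ≈ (fzero ∷ shift (a ++ b))
front-slide {m} {a} b avoids = begin
  shift a ++ fzero ∷ shift b       ≡⟨ sym (++-assoc (shift a) [ fzero ] (shift b)) ⟩
  (shift a ++ [ fzero ]) ++ shift b ≈⟨ ≈-++ʳ (shift b) (≈-sym (commute-past fzero (shift a) (shift-far avoids))) ⟩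
  fzero ∷ shift a ++ shift b       ≡⟨ cong (fzero ∷_) (sym (map-++ fsuc a b)) ⟩
  fzero ∷ shift (a ++ b)           ∎
  where open SetoidReasoning (≈-setoid (suc m))

back-slide : ∀ {m} (a : Word m) {b : Word m} → AvoidsFirst b →
             (shift a ++ fzero ∷ shift b) ≈ (shift (a ++ b) ++ [ fzero ])
back-slide {m} a {b} avoids = begin
  shift a ++ fzero ∷ shift b        ≈⟨ ≈-++ˡ (shift a) (commute-past fzero (shift b) (shift-far avoids)) ⟩
  shift a ++ shift b ++ [ fzero ]   ≡⟨ sym (++-assoc (shift a) (shift b) [ fzero ]) ⟩
  (shift a ++ shift b) ++ [ fzero ] ≡⟨ cong (_++ [ fzero ]) (sym (map-++ fsuc a b)) ⟩
  shift (a ++ b) ++ [ fzero ]       ∎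
  where open SetoidReasoning (≈-setoid (suc m))

unique-++-disjoint : ∀ {A : Set} (xs : List A) {ys : List A} → Unique (xs ++ ys) → Disjoint xs ys
unique-++-disjoint (x ∷ xs) (x∉ ∷ _) (here refl , x∈ys) = All.lookup (AllP.++⁻ʳ xs x∉) x∈ys refl
unique-++-disjoint (x ∷ xs) (_ ∷ u)  (there v∈xs , v∈ys) = unique-++-disjoint xs u (v∈xs , v∈ys)

later-or-first : ∀ {m} (j : Fin m) → 1 ≤ toℕ j ⊎ toℕ j ≡ 0
later-or-first fzero    = inj₂ refl
later-or-first (fsuc j) = inj₁ (s≤s z≤n)

-- In a simple word x₁ occurs at most once, so it avoids x₁ on one side.
avoids-one-side : ∀ {m} (a b : Word m) → Unique (a ++ b) → AvoidsFirst a ⊎ AvoidsFirst b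
avoids-one-side a b simple with All.decide later-or-first a | All.decide later-or-first b
... | inj₁ avoids-a | _            = inj₁ avoids-a
... | inj₂ _        | inj₁ avoids-b = inj₂ avoids-b
... | inj₂ first-a  | inj₂ first-b
  with find first-a | find first-b
... | j , j∈a , j≡0 | k , k∈b , k≡0 =
  ⊥-elim (unique-++-disjoint a simple (j∈a , subst (_∈ b) (toℕ-injective (trans k≡0 (sym j≡0))) k∈b))

not-first-or-first : ∀ {m} (j : Fin (suc m)) → fzero ≢ j ⊎ fzero ≡ j
not-first-or-first fzero    = inj₂ refl
not-first-or-first (fsuc j) = inj₁ (λ ())

unshift : ∀ {m} (w : Word (suc m)) → All (fzero ≢_) w → Σ (Word m) (λ w′ → w ≡ shift w′)
unshift []           []         = [] , refl
unshift (fzero ∷ w)  (ne ∷ _)   = ⊥-elim (ne refl)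
unshift (fsuc i ∷ w) (_ ∷ nes) with unshift w nes
... | w′ , refl = i ∷ w′ , refl

split-at-first : ∀ {m} (w : Word (suc m)) → Unique w → fzero ∈ w →
                 Σ (Word m) λ a → Σ (Word m) λ b → w ≡ shift a ++ fzero ∷ shift b × Unique (a ++ b)
split-at-first w simple first∈ with ∈-∃++ first∈
... | ys , zs , refl
  with PermP.Unique-resp-↭ (setoid _) (PermP.↭-shift (setoid _) ys zs) simple
... | first∉ ∷ simple-rest
  with unshift ys (AllP.++⁻ˡ ys first∉) | unshift zs (AllP.++⁻ʳ ys first∉)
... | a , refl | b , refl =
  a , b , refl , UniqueP.map⁻ (subst Unique (sym (map-++ fsuc a b)) simple-rest)

front∈canonical : ∀ {m} {c : Word m} → c ∈ canonical m → front c ∈ canonical (suc m)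
front∈canonical {m} c∈ = ∈-++⁺ʳ (map shift (canonical m)) (∈-++⁺ˡ (∈-map⁺ front c∈))

back∈canonical : ∀ {m} {c : Word m} → c ∈ containing m → back c ∈ canonical (suc m)
back∈canonical {m} c∈ = ∈-++⁺ʳ (map shift (canonical m)) (∈-++⁺ʳ (map front (canonical m)) (∈-map⁺ back c∈))

-- The back-word of a canonical word is equivalent to a canonical word: it is
-- itself canonical, or x₁ commutes to the front.
back-canonical : ∀ {m} {c : Word m} → c ∈ canonical m → Any (back c ≈_) (canonical (suc m))
back-canonical {m} {c} c∈ with ∈-++⁻ (avoiding m) c∈
... | inj₁ c∈avoiding = lose (front∈canonical c∈) (≈-sym front≈back)
  where
  front≈back : front c ≈ back c
  front≈back = commute-past fzero (shift c) (shift-far (All.lookup (avoiding-avoids-first m) c∈avoiding))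
... | inj₂ c∈containing = lose (back∈canonical c∈containing) ≈-refl

slide-to-canonical : ∀ {m} (a b : Word m) → Unique (a ++ b) →
                     {c : Word m} → c ∈ canonical m → (a ++ b) ≈ c →
                     Any ((shift a ++ fzero ∷ shift b) ≈_) (canonical (suc m))
slide-to-canonical a b simple c∈ ab≈c with avoids-one-side a b simple
... | inj₁ avoids-a =
  lose (front∈canonical c∈) (≈-trans (front-slide b avoids-a) (≈-++ˡ [ fzero ] (≈-shift ab≈c)))
... | inj₂ avoids-b =
  Any.map (≈-trans (≈-trans (back-slide a avoids-b) (≈-++ʳ [ fzero ] (≈-shift ab≈c))))
          (back-canonical c∈)

canonical-complete : ∀ m (w : Word m) → SimpleWord w → Any (w ≈_) (canonical m)
canonical-complete zero    []      _ = here ≈-refl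
canonical-complete (suc m) w simple with All.decide not-first-or-first w
... | inj₁ first∉ with unshift w first∉
...   | w′ , refl with find (canonical-complete m w′ (UniqueP.map⁻ simple))
...     | c , c∈ , w′≈c = lose (∈-++⁺ˡ (∈-map⁺ shift c∈)) (≈-shift w′≈c)
canonical-complete (suc m) w simple | inj₂ first∈ with split-at-first w simple first∈
... | a , b , refl , simple-ab with find (canonical-complete m (a ++ b) simple-ab)
...   | c , c∈ , ab≈c = slide-to-canonical a b simple-ab c∈ ab≈c

theorem1p4 : (n : ℕ) → 1 ≤ n → CountSimpleBraids n (fib (2 * n ∸ 1))
theorem1p4 zero    ()
theorem1p4 (suc m) _  =
  canonical m ,
  trans (length-canonical m) (cong fib (sym (double-suc-pred m))) ,
  canonical-simple m ,
  canonical-distinct m ,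
  canonical-complete m
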